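{- Let $Q$ be a quiver with large weights and $i$ a vertex of $Q$ such that: (A) $i$ is an ascent in every cyclic 3-vertex full subquiver of $Q$ containing $i$; (B) $i$ is not a sink or source in $Q$; (C) $i$ is not the apex of a vortex in $Q$. Let $i,i_1,\dots,i_m$ be a sequence with $i\ne i_1\ne\cdots\ne i_m$. Then the orientations of arrows in the quiver $\mu[i_m\cdots i_1 i](Q)$ are uniquely determined by the orientations of arrows in $Q$. That is, if $Q'$ is another quiver on the same vertex set with large weights, with the same orientations of arrows as $Q$, and such that $(Q',i)$ satisfies (A), (B), (C), then $\mu[i_m\cdots i_1 i](Q)$ and $\mu[i_m\cdots i_1 i](Q')$ have the same orientations of arrows.
   Context: Quivers are finite directed multigraphs without loops or oriented 2-cycles, encoded by skew-symmetric $B(Q)=(b_{uv})$; mutation at $k$: $b'_{uv}=-b_{uv}$ if $k\in\{u,v\}$, else $b'_{uv}=b_{uv}+\tfrac12(|b_{uk}|b_{kv}+b_{uk}|b_{kv}|)$; $\mu[i_m\cdots i_1 i]$ means mutate at $i$ first, then $i_1$, ..., finally $i_m$. Large weights: $|b_{uv}|\ge 2$ for all $u\ne v$. Two quivers on the same vertex set have the same orientations of arrows if for every pair $u,v$, all arrows between $u$ and $v$ go from $u$ to $v$ in one iff they do in the other. Write $u\dashrightarrow v$ if $b_{uv}\ge0$; a sink (source) is a vertex $j$ with $v\dashrightarrow j$ ($j\dashrightarrow v$) for all other $v$. Full subquiver = induced subgraph. A 3-vertex quiver is cyclic if it contains an oriented 3-cycle. In a 3-vertex quiver on $\{i,j,k\}$,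 $i$ is an ascent if $|b_{jk}(\mu[i](Q))|>|b_{jk}(Q)|$. A vortex is a 4-vertex quiver with all weights nonzero, one vertex (the apex) a sink or source, and the remaining three supporting a cyclic 3-vertex subquiver; a vortex in $Q$ is a full 4-vertex subquiver that is a vortex. -}

module Defs where

open import Data.Nat using (ℕ)
open import Data.Fin using (Fin)
open import Data.Integer using (ℤ; +_; -_; _+_; _*_; _<_; _≤_; _<?_; ∣_∣)
open import Data.List using (List; []; _∷_)
open import Data.List.Relation.Unary.Linked using (Linked)
open import Data.Product using (_×_; ∃-syntax)
open import Data.Sum using (_⊎_)
open import Data.Bool using (if_then_else_)
open import Relation.Binary.PropositionalEquality using (_≡_; _≢_)
open import Relation.Nullary.Decidable using (⌊_⌋)
open import Data.Fin using (_≟_)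
open import Function.Bundles using (_⇔_)

-- A quiver on vertex set Fin n, encoded by its exchange matrix B(Q) = (b_uv).
Matrix : ℕ → Set
Matrix n = Fin n → Fin n → ℤ

SkewSymmetric : ∀ {n} → Matrix n → Set
SkewSymmetric {n} B = ∀ (u v : Fin n) → B u v ≡ - B v u

LargeWeights : ∀ {n} → Matrix n → Set
LargeWeights {n} B = ∀ (u v : Fin n) → u ≢ v → 2 Data.Nat.≤ ∣ B u v ∣

-- The correction term ½(|b_uk| b_kv + b_uk |b_kv|), written out:
-- it equals b_uk b_kv if both are positive, -b_uk b_kv if both are negative,
-- and 0 otherwise.
halfTerm : ℤ → ℤ → ℤ
halfTerm a b =
  if ⌊ + 0 <? a ⌋ then (if ⌊ + 0 <? b ⌋ then a * b else + 0)
  else (if ⌊ a <? + 0 ⌋ then (if ⌊ b <? + 0 ⌋ then - (a * b) else + 0) else + 0)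

mutate : ∀ {n} → Fin n → Matrix n → Matrix n
mutate k B u v =
  if ⌊ u ≟ k ⌋ then - B u v
  else (if ⌊ v ≟ k ⌋ then - B u v
  else B u v + halfTerm (B u k) (B k v))

-- mutSeq B (i ∷ i₁ ∷ ⋯ ∷ iₘ ∷ []) = μ[iₘ ⋯ i₁ i](B): mutate at i first, ..., at iₘ last.
mutSeq : ∀ {n} → Matrix n → List (Fin n) → Matrix n
mutSeq B [] = B
mutSeq B (k ∷ ks) = mutSeq (mutate k B) ks

_⊢_⇢_ : ∀ {n} → Matrix n → Fin n → Fin n → Set
B ⊢ u ⇢ v = + 0 ≤ B u v

SameOrientations : ∀ {n} → Matrix n → Matrix n → Set
SameOrientations {n} B B' = ∀ (u v : Fin n) → (+ 0 < B u v) ⇔ (+ 0 < B' u v)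

Sink : ∀ {n} → Matrix n → Fin n → Set
Sink {n} B j = ∀ (v : Fin n) → v ≢ j → B ⊢ v ⇢ j

Source : ∀ {n} → Matrix n → Fin n → Set
Source {n} B j = ∀ (v : Fin n) → v ≢ j → B ⊢ j ⇢ v

Distinct3 : ∀ {n} → Fin n → Fin n → Fin n → Set
Distinct3 i j k = (i ≢ j) × (i ≢ k) × (j ≢ k)

Cyclic3 : ∀ {n} → Matrix n → Fin n → Fin n → Fin n → Set
Cyclic3 B i j k =
  ((+ 0 < B i j) × (+ 0 < B j k) × (+ 0 < B k i)) ⊎
  ((+ 0 < B j i) × (+ 0 < B k j) × (+ 0 < B i k))

-- In the full subquiver on {i,j,k}, i is an ascent: |b_jk(μ_i Q)| > |b_jk(Q)|.
-- (Mutating Q at i and restricting agrees with mutating the subquiver at i.)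
Ascent : ∀ {n} → Matrix n → Fin n → Fin n → Fin n → Set
Ascent B i j k = ∣ B j k ∣ Data.Nat.< ∣ mutate i B j k ∣

CondA : ∀ {n} → Matrix n → Fin n → Set
CondA {n} B i = ∀ (j k : Fin n) → Distinct3 i j k → Cyclic3 B i j k → Ascent B i j k

CondB : ∀ {n} → Matrix n → Fin n → Set
CondB B i = (Sink B i → Data.Empty.⊥) × (Source B i → Data.Empty.⊥)
  where import Data.Empty

ApexOfVortex : ∀ {n} → Matrix n → Fin n → Set
ApexOfVortex {n} B i = ∃[ x ] ∃[ y ] ∃[ z ]
  ( Distinct3 x y z × (i ≢ x) × (i ≢ y) × (i ≢ z)
  × ((B i x ≢ + 0) × (B i y ≢ + 0) × (B i z ≢ + 0)
     × (B x y ≢ + 0) × (B x z ≢ + 0) × (B y z ≢ + 0))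
  × (((B ⊢ x ⇢ i) × (B ⊢ y ⇢ i) × (B ⊢ z ⇢ i))
     ⊎ ((B ⊢ i ⇢ x) × (B ⊢ i ⇢ y) × (B ⊢ i ⇢ z)))
  × Cyclic3 B x y z )

CondC : ∀ {n} → Matrix n → Fin n → Set
CondC B i = ApexOfVortex B i → Data.Empty.⊥
  where import Data.Empty

Admissible : ∀ {n} → Matrix n → Fin n → Set
Admissible B i = SkewSymmetric B × LargeWeights B × CondA B i × CondB B i × CondC B i

-- Mutation at i changes b_uv (u, v ≠ i) only along a path u → i → v, by adding b_ui b_iv > 0; if
-- the arrow went v → u, then u, i, v is a cyclic triangle in which i is an ascent, so the new arrow
-- points u → v.  Hence the orientations of μ_i Q are a function of those of Q.  To iterate, note
-- that μ_i Q again has large weights and every k ≠ i satisfies (A) and (C) in it: a cyclic triangle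
-- of μ_i Q avoiding i would lie on one side of i, where nothing changed, and so be the base of a
-- vortex of Q with apex i; in a cyclic triangle k, i, l of μ_i Q the ascent of i in Q and
-- |b_ki| ≥ 2 make k an ascent; and a vortex of μ_i Q with apex k would contain such a triangle,
-- whose path through i forces an arrow contradicting k being a sink or source.

module Submission where

open import Defs
open import Data.Nat as ℕ using (ℕ)
import Data.Nat.Properties as ℕ
import Data.Nat.Tactic.RingSolver as ℕ-Ring
open import Data.Integer using (ℤ; +_; -_; +[1+_]; -[1+_]; _+_; _*_; _<_; _≤_; ∣_∣; +<+; +≤+; _<?_)
import Data.Integer.Properties as ℤ
open import Data.Integer.Tactic.RingSolver using (solve-∀)
open import Data.Fin using (Fin; _≟_)
open import Data.List using (List; []; _∷_)
open import Data.List.Relation.Unary.Linked using (Linked; _∷_)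
open import Data.Product using (_×_; _,_; proj₁; proj₂)
open import Data.Sum using (_⊎_; inj₁; inj₂)
open import Function.Bundles using (_⇔_; mk⇔; Equivalence)
open import Data.Empty using (⊥; ⊥-elim)
open import Relation.Nullary using (¬_; Dec; yes; no; contradiction)
open import Relation.Binary.PropositionalEquality

private
  variable
    i j : ℤ

double-cancel-< : ∀ {x y} → x ℕ.+ x ℕ.< y ℕ.+ y → x ℕ.< y
double-cancel-< x+x<y+y = ℕ.≰⇒> (λ y≤x → ℕ.<⇒≱ x+x<y+y (ℕ.+-mono-≤ y≤x y≤x))

double-<-* : ∀ {a b c} → 2 ℕ.≤ a → a ℕ.* b ℕ.< c ℕ.+ c → b ℕ.+ b ℕ.< a ℕ.* c
double-<-* {a@(ℕ.suc _)} {b} {c} 2≤a ab<2c = double-cancel-< (begin-strict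
    (b ℕ.+ b) ℕ.+ (b ℕ.+ b) ≡⟨ four b ⟩
    2 ℕ.* (2 ℕ.* b)         ≤⟨ ℕ.*-mono-≤ 2≤a (ℕ.*-monoˡ-≤ b 2≤a) ⟩
    a ℕ.* (a ℕ.* b)         <⟨ ℕ.*-monoʳ-< a ab<2c ⟩
    a ℕ.* (c ℕ.+ c)         ≡⟨ ℕ.*-distribˡ-+ a c c ⟩
    a ℕ.* c ℕ.+ a ℕ.* c     ∎)
  where
    open ℕ.≤-Reasoning
    four : ∀ b → (b ℕ.+ b) ℕ.+ (b ℕ.+ b) ≡ 2 ℕ.* (2 ℕ.* b)
    four = ℕ-Ring.solve-∀

i≡-i⇒i≡0 : i ≡ - i → i ≡ + 0
i≡-i⇒i≡0 {+ 0}      _ = refl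
i≡-i⇒i≡0 {+[1+ _ ]} ()
i≡-i⇒i≡0 { -[1+ _ ]} ()

*-pos : + 0 < i → + 0 < j → + 0 < i * j
*-pos (+<+ (ℕ.s≤s ℕ.z≤n)) (+<+ (ℕ.s≤s ℕ.z≤n)) = +<+ (ℕ.s≤s ℕ.z≤n)

∣∣-≡-neg : i ≡ - j → ∣ i ∣ ≡ ∣ j ∣
∣∣-≡-neg {j = j} i≡-j = trans (cong ∣_∣ i≡-j) (ℤ.∣-i∣≡∣i∣ j)

∣∣-mono-≤ : + 0 ≤ i → i ≤ j → ∣ i ∣ ℕ.≤ ∣ j ∣
∣∣-mono-≤ (+≤+ _) (+≤+ m≤n) = m≤n

∣∣-mono-< : + 0 ≤ i → i < j → ∣ i ∣ ℕ.< ∣ j ∣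
∣∣-mono-< (+≤+ _) (+<+ m<n) = m<n

∣∣-antimono-≤ : i ≤ j → j ≤ + 0 → ∣ j ∣ ℕ.≤ ∣ i ∣
∣∣-antimono-≤ {i} {j} i≤j j≤0 =
  subst₂ ℕ._≤_ (ℤ.∣-i∣≡∣i∣ j) (ℤ.∣-i∣≡∣i∣ i) (∣∣-mono-≤ (ℤ.neg-mono-≤ j≤0) (ℤ.neg-mono-≤ i≤j))

∣∣-<-pos : i ≤ j → ∣ i ∣ ℕ.< ∣ j ∣ → + 0 < j
∣∣-<-pos i≤j ∣i∣<∣j∣ = ℤ.≰⇒> (λ j≤0 → ℕ.<⇒≱ ∣i∣<∣j∣ (∣∣-antimono-≤ i≤j j≤0))

i<i+j : ∀ {i j} → + 0 < j → i < i + j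
i<i+j {i} {j} 0<j = subst (_< i + j) (ℤ.+-identityʳ i) (ℤ.+-monoʳ-< i 0<j)

+-pos-∣∣-mono : ∀ x {p} → + 0 < p → (x < + 0 → ∣ x ∣ ℕ.< ∣ x + p ∣)
              → + 0 < x + p × ∣ x ∣ ℕ.≤ ∣ x + p ∣
+-pos-∣∣-mono x 0<p grows with x <? + 0
... | yes x<0 = ∣∣-<-pos (ℤ.<⇒≤ (i<i+j {x} 0<p)) (grows x<0) , ℕ.<⇒≤ (grows x<0)
... | no x≮0  = ℤ.+-mono-≤-< 0≤x 0<p , ∣∣-mono-≤ 0≤x (ℤ.<⇒≤ (i<i+j {x} 0<p))
  where 0≤x = ℤ.≮⇒≥ x≮0

neg-<-pos : + 0 < j → (i < + 0 → ∣ i ∣ ℕ.< ∣ j ∣) → - i < j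
neg-<-pos {j} {i} 0<j grows with i <? + 0
... | yes i<0 = subst₂ _<_ (∣∣-self-neg i<0) (ℤ.0≤i⇒+∣i∣≡i (ℤ.<⇒≤ 0<j)) (+<+ (grows i<0))
  where
    ∣∣-self-neg : i < + 0 → + ∣ i ∣ ≡ - i
    ∣∣-self-neg i<0 = trans (cong +_ (sym (ℤ.∣-i∣≡∣i∣ i))) (ℤ.0≤i⇒+∣i∣≡i (ℤ.neg-mono-≤ (ℤ.<⇒≤ i<0)))
... | no i≮0  = ℤ.≤-<-trans (ℤ.neg-mono-≤ (ℤ.≮⇒≥ i≮0)) 0<j

double-<-*-nonNeg : + 0 ≤ i → + 0 ≤ j → ∀ {k} → + 0 ≤ k → 2 ℕ.≤ ∣ i ∣ → i * j < k + k → j + j < i * k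
double-<-*-nonNeg {+ a} {+ b} (+≤+ _) (+≤+ _) {+ c} (+≤+ _) 2≤a ab<2c =
  subst₂ _<_ (ℤ.pos-+ b b) (ℤ.pos-* a c)
    (+<+ (double-<-* 2≤a (ℤ.drop‿+<+ (subst₂ _<_ (sym (ℤ.pos-* a b)) (sym (ℤ.pos-+ c c)) ab<2c))))

∣-i∣<∣-i+j∣ : + 0 ≤ i → i + i < j → ∣ - i ∣ ℕ.< ∣ - i + j ∣
∣-i∣<∣-i+j∣ {i} {j} 0≤i 2i<j =
  subst (ℕ._< ∣ - i + j ∣) (sym (ℤ.∣-i∣≡∣i∣ i)) (∣∣-mono-< 0≤i i<-i+j)
  where
    cancel : ∀ i → - i + (i + i) ≡ i
    cancel = solve-∀
    i<-i+j : i < - i + j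
    i<-i+j = subst (_< - i + j) (cancel i) (ℤ.+-monoʳ-< (- i) 2i<j)

OppositeSigns : ℤ → ℤ → Set
OppositeSigns a b = (a ≤ + 0 × + 0 ≤ b) ⊎ (+ 0 ≤ a × b ≤ + 0)

halfTerm-pos-pos : ∀ {a b} → + 0 < a → + 0 < b → halfTerm a b ≡ a * b
halfTerm-pos-pos {a} {b} 0<a 0<b with + 0 <? a | + 0 <? b
... | yes _  | yes _  = refl
... | no 0≮a | _      = contradiction 0<a 0≮a
... | yes _  | no 0≮b = contradiction 0<b 0≮b

halfTerm-neg-neg : ∀ {a b} → a < + 0 → b < + 0 → halfTerm a b ≡ - (a * b)
halfTerm-neg-neg {a} {b} a<0 b<0 with + 0 <? a | a <? + 0 | b <? + 0
... | yes 0<a | _      | _      = contradiction a<0 (ℤ.<-asym 0<a)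
... | no _    | yes _  | yes _  = refl
... | no _    | no a≮0 | _      = contradiction a<0 a≮0
... | no _    | yes _  | no b≮0 = contradiction b<0 b≮0

halfTerm-opposite : ∀ {a b} → OppositeSigns a b → halfTerm a b ≡ + 0
halfTerm-opposite {a} {b} (inj₁ (a≤0 , 0≤b)) with + 0 <? a | a <? + 0 | b <? + 0
... | yes 0<a | _     | _     = contradiction a≤0 (ℤ.<⇒≱ 0<a)
... | no _    | yes _ | yes b<0 = contradiction 0≤b (ℤ.<⇒≱ b<0)
... | no _    | yes _ | no _  = refl
... | no _    | no _  | _     = refl
halfTerm-opposite {a} {b} (inj₂ (0≤a , b≤0)) with + 0 <? a | + 0 <? b | a <? + 0
... | yes _ | yes 0<b | _       = contradiction b≤0 (ℤ.<⇒≱ 0<b)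
... | yes _ | no _    | _       = refl
... | no _  | _       | yes a<0 = contradiction 0≤a (ℤ.<⇒≱ a<0)
... | no _  | _       | no _    = refl

OppositeSigns-swap : ∀ {a b} → OppositeSigns a b → OppositeSigns b a
OppositeSigns-swap (inj₁ (a≤0 , 0≤b)) = inj₂ (0≤b , a≤0)
OppositeSigns-swap (inj₂ (0≤a , b≤0)) = inj₁ (b≤0 , 0≤a)

OppositeSigns-neg : ∀ {a b} → OppositeSigns a b → OppositeSigns (- a) (- b)
OppositeSigns-neg (inj₁ (a≤0 , 0≤b)) = inj₂ (ℤ.neg-mono-≤ a≤0 , ℤ.neg-mono-≤ 0≤b)
OppositeSigns-neg (inj₂ (0≤a , b≤0)) = inj₁ (ℤ.neg-mono-≤ 0≤a , ℤ.neg-mono-≤ b≤0)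

data SignPair (a b : ℤ) : Set where
  both-pos : + 0 < a → + 0 < b → SignPair a b
  both-neg : a < + 0 → b < + 0 → SignPair a b
  opposite : OppositeSigns a b → SignPair a b

signPair : ∀ a b → SignPair a b
signPair a b with + 0 <? a | + 0 <? b
... | yes 0<a | yes 0<b = both-pos 0<a 0<b
... | yes 0<a | no 0≮b  = opposite (inj₂ (ℤ.<⇒≤ 0<a , ℤ.≮⇒≥ 0≮b))
... | no 0≮a  | yes 0<b = opposite (inj₁ (ℤ.≮⇒≥ 0≮a , ℤ.<⇒≤ 0<b))
... | no 0≮a  | no 0≮b with a <? + 0 | b <? + 0
...   | yes a<0 | yes b<0 = both-neg a<0 b<0
...   | yes a<0 | no b≮0  = opposite (inj₁ (ℤ.<⇒≤ a<0 , ℤ.≮⇒≥ b≮0))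
...   | no a≮0  | _       = opposite (inj₂ (ℤ.≮⇒≥ a≮0 , ℤ.≮⇒≥ 0≮b))

halfTerm-comm : ∀ a b → halfTerm a b ≡ halfTerm b a
halfTerm-comm a b with signPair a b
... | both-pos 0<a 0<b = trans (halfTerm-pos-pos 0<a 0<b)
                           (trans (ℤ.*-comm a b) (sym (halfTerm-pos-pos 0<b 0<a)))
... | both-neg a<0 b<0 = trans (halfTerm-neg-neg a<0 b<0)
                           (trans (cong -_ (ℤ.*-comm a b)) (sym (halfTerm-neg-neg b<0 a<0)))
... | opposite o = trans (halfTerm-opposite o) (sym (halfTerm-opposite (OppositeSigns-swap o)))

neg-halfTerm : ∀ a b → halfTerm (- a) (- b) ≡ - halfTerm a b
neg-halfTerm a b with signPair a b
... | both-pos 0<a 0<b = begin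
  halfTerm (- a) (- b) ≡⟨ halfTerm-neg-neg (ℤ.neg-mono-< 0<a) (ℤ.neg-mono-< 0<b) ⟩
  - (- a * - b)        ≡⟨ cong -_ (neg*neg a b) ⟩
  - (a * b)            ≡⟨ cong -_ (halfTerm-pos-pos 0<a 0<b) ⟨
  - halfTerm a b       ∎
  where
    open ≡-Reasoning
    neg*neg : ∀ a b → - a * - b ≡ a * b
    neg*neg = solve-∀
... | both-neg a<0 b<0 = begin
  halfTerm (- a) (- b) ≡⟨ halfTerm-pos-pos (ℤ.neg-mono-< a<0) (ℤ.neg-mono-< b<0) ⟩
  - a * - b            ≡⟨ neg*neg a b ⟩
  - - (a * b)          ≡⟨ cong -_ (halfTerm-neg-neg a<0 b<0) ⟨
  - halfTerm a b       ∎
  where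
    open ≡-Reasoning
    neg*neg : ∀ a b → - a * - b ≡ - - (a * b)
    neg*neg = solve-∀
... | opposite o = trans (halfTerm-opposite (OppositeSigns-neg o)) (cong -_ (sym (halfTerm-opposite o)))

-- For α = b_ki, β = b_il and γ = b_kl, these are b_kl(μ_i B) and b_il(μ_k μ_i B).
mutated-kl : ℤ → ℤ → ℤ → ℤ
mutated-kl α β γ = γ + halfTerm α β

mutated-il : ℤ → ℤ → ℤ → ℤ
mutated-il α β γ = - β + halfTerm α (mutated-kl α β γ)

mutated-kl-neg : ∀ α β γ → mutated-kl (- α) (- β) (- γ) ≡ - mutated-kl α β γ
mutated-kl-neg α β γ =
  trans (cong (λ h → - γ + h) (neg-halfTerm α β)) (sym (ℤ.neg-distrib-+ γ (halfTerm α β)))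

mutated-il-neg : ∀ α β γ → mutated-il (- α) (- β) (- γ) ≡ - mutated-il α β γ
mutated-il-neg α β γ = begin
  - - β + halfTerm (- α) (mutated-kl (- α) (- β) (- γ)) ≡⟨ cong (λ c → - - β + halfTerm (- α) c) (mutated-kl-neg α β γ) ⟩
  - - β + halfTerm (- α) (- c)                          ≡⟨ cong (λ h → - - β + h) (neg-halfTerm α c) ⟩
  - - β + - halfTerm α c                                ≡⟨ ℤ.neg-distrib-+ (- β) (halfTerm α c) ⟨
  - mutated-il α β γ                                    ∎
  where
    open ≡-Reasoning
    c = mutated-kl α β γ

-- The hypothesis on γ < 0 is the ascent of i in the cyclic triangle i → l → k → i of B;
-- it gives α β < 2 b_kl(μ_i B), and large weights (α ≥ 2) then make the new |b_il| grow.
triangle-ascent⁺ : ∀ {α β γ} → + 0 < α → 2 ℕ.≤ ∣ α ∣ → + 0 < β → + 0 < mutated-kl α β γ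
                 → (γ < + 0 → ∣ γ ∣ ℕ.< ∣ mutated-kl α β γ ∣)
                 → ∣ - β ∣ ℕ.< ∣ mutated-il α β γ ∣
triangle-ascent⁺ {α} {β} {γ} 0<α 2≤∣α∣ 0<β 0<c grows =
  subst (λ t → ∣ - β ∣ ℕ.< ∣ - β + t ∣) (sym (halfTerm-pos-pos 0<α 0<c))
    (∣-i∣<∣-i+j∣ (ℤ.<⇒≤ 0<β) (double-<-*-nonNeg (ℤ.<⇒≤ 0<α) (ℤ.<⇒≤ 0<β) (ℤ.<⇒≤ 0<c) 2≤∣α∣ αβ<2c))
  where
    c = mutated-kl α β γ
    split : ∀ γ h → h ≡ (γ + h) + - γ
    split = solve-∀
    αβ<2c : α * β < c + c
    αβ<2c = subst (_< c + c) (trans (sym (split γ (halfTerm α β))) (halfTerm-pos-pos 0<α 0<β))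
                  (ℤ.+-monoʳ-< c (neg-<-pos 0<c grows))

triangle-ascent⁻ : ∀ {α β γ} → α < + 0 → 2 ℕ.≤ ∣ α ∣ → β < + 0 → mutated-kl α β γ < + 0
                 → (+ 0 < γ → ∣ γ ∣ ℕ.< ∣ mutated-kl α β γ ∣)
                 → ∣ - β ∣ ℕ.< ∣ mutated-il α β γ ∣
triangle-ascent⁻ {α} {β} {γ} α<0 2≤∣α∣ β<0 c<0 grows =
  subst₂ ℕ._<_ (ℤ.∣-i∣≡∣i∣ (- β)) (∣∣-≡-neg (mutated-il-neg α β γ))
    (triangle-ascent⁺ (ℤ.neg-mono-< α<0) (subst (2 ℕ.≤_) (sym (ℤ.∣-i∣≡∣i∣ α)) 2≤∣α∣)
                      (ℤ.neg-mono-< β<0) (subst (+ 0 <_) (sym (mutated-kl-neg α β γ)) (ℤ.neg-mono-< c<0))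
                      grows⁻)
  where
    grows⁻ : - γ < + 0 → ∣ - γ ∣ ℕ.< ∣ mutated-kl (- α) (- β) (- γ) ∣
    grows⁻ -γ<0 = subst₂ ℕ._<_ (sym (ℤ.∣-i∣≡∣i∣ γ)) (sym (∣∣-≡-neg (mutated-kl-neg α β γ)))
                         (grows (ℤ.neg-cancel-< -γ<0))

module _ {n : ℕ} where

  _⊢_⟶_ : Matrix n → Fin n → Fin n → Set
  B ⊢ u ⟶ v = + 0 < B u v

  private
    variable
      B : Matrix n
      k u v x y z : Fin n

  skew-diag : SkewSymmetric B → ∀ u → B u u ≡ + 0
  skew-diag sk u = i≡-i⇒i≡0 (sk u u)

  skew-pos⇒neg : SkewSymmetric B → B ⊢ u ⟶ v → B v u < + 0
  skew-pos⇒neg {B} {u} {v} sk 0<Buv = subst (_< + 0) (sym (sk v u)) (ℤ.neg-mono-< 0<Buv)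

  skew-neg⇒pos : SkewSymmetric B → B u v < + 0 → B ⊢ v ⟶ u
  skew-neg⇒pos {B} {u} {v} sk Buv<0 = subst (+ 0 <_) (sym (sk v u)) (ℤ.neg-mono-< Buv<0)

  skew-∣∣ : SkewSymmetric B → ∀ u v → ∣ B u v ∣ ≡ ∣ B v u ∣
  skew-∣∣ sk u v = ∣∣-≡-neg (sk u v)

  large⇒nonzero : LargeWeights B → u ≢ v → B u v ≢ + 0
  large⇒nonzero {B} {u} {v} lg u≢v Buv≡0 with subst (2 ℕ.≤_) (cong ∣_∣ Buv≡0) (lg u v u≢v)
  ... | ()

  large-nonneg⇒pos : LargeWeights B → u ≢ v → + 0 ≤ B u v → B ⊢ u ⟶ v
  large-nonneg⇒pos {B} lg u≢v 0≤Buv = ℤ.≤∧≢⇒< 0≤Buv (≢-sym (large⇒nonzero {B = B} lg u≢v))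

  arrow-either : SkewSymmetric B → LargeWeights B → u ≢ v → B ⊢ u ⟶ v ⊎ B ⊢ v ⟶ u
  arrow-either {B} {u} {v} sk lg u≢v with + 0 <? B u v
  ... | yes 0<Buv  = inj₁ 0<Buv
  ... | no 0≮Buv   = inj₂ (skew-neg⇒pos sk (ℤ.≤∧≢⇒< (ℤ.≮⇒≥ 0≮Buv) (large⇒nonzero {B = B} lg u≢v)))

  Cyclic3-swap : ∀ (B : Matrix n) x y z → Cyclic3 B x y z → Cyclic3 B x z y
  Cyclic3-swap _ _ _ _ (inj₁ (xy , yz , zx)) = inj₂ (zx , yz , xy)
  Cyclic3-swap _ _ _ _ (inj₂ (yx , zy , xz)) = inj₁ (xz , zy , yx)

  Cyclic3-rotate : ∀ (B : Matrix n) x y z → Cyclic3 B x y z → Cyclic3 B y z x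
  Cyclic3-rotate _ _ _ _ (inj₁ (xy , yz , zx)) = inj₁ (yz , zx , xy)
  Cyclic3-rotate _ _ _ _ (inj₂ (yx , zy , xz)) = inj₂ (zy , xz , yx)

  Cyclic3-transfer : ∀ {B B′} (P : Fin n → Set) → P x → P y → P z
                   → (∀ {p q} → P p → P q → B p q ≡ B′ p q)
                   → Cyclic3 B x y z → Cyclic3 B′ x y z
  Cyclic3-transfer P px py pz agree (inj₁ (xy , yz , zx)) =
    inj₁ (subst (+ 0 <_) (agree px py) xy , subst (+ 0 <_) (agree py pz) yz , subst (+ 0 <_) (agree pz px) zx)
  Cyclic3-transfer P px py pz agree (inj₂ (yx , zy , xz)) =
    inj₂ (subst (+ 0 <_) (agree py px) yx , subst (+ 0 <_) (agree pz py) zy , subst (+ 0 <_) (agree px pz) xz)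

  SinkOrSourceOf : Matrix n → Fin n → Fin n → Fin n → Fin n → Set
  SinkOrSourceOf B k x y z = ((B ⊢ x ⇢ k) × (B ⊢ y ⇢ k) × (B ⊢ z ⇢ k))
                           ⊎ ((B ⊢ k ⇢ x) × (B ⊢ k ⇢ y) × (B ⊢ k ⇢ z))

  SinkOrSourceOf-rotate : ∀ (B : Matrix n) k x y z → SinkOrSourceOf B k x y z → SinkOrSourceOf B k y z x
  SinkOrSourceOf-rotate _ _ _ _ _ (inj₁ (xk , yk , zk)) = inj₁ (yk , zk , xk)
  SinkOrSourceOf-rotate _ _ _ _ _ (inj₂ (kx , ky , kz)) = inj₂ (ky , kz , kx)

  SinkOrSourceOf-swap : ∀ (B : Matrix n) k x y z → SinkOrSourceOf B k x y z → SinkOrSourceOf B k x z y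
  SinkOrSourceOf-swap _ _ _ _ _ (inj₁ (xk , yk , zk)) = inj₁ (xk , zk , yk)
  SinkOrSourceOf-swap _ _ _ _ _ (inj₂ (kx , ky , kz)) = inj₂ (kx , kz , ky)

  apexOfVortex : LargeWeights B → Distinct3 x y z → k ≢ x → k ≢ y → k ≢ z
               → SinkOrSourceOf B k x y z → Cyclic3 B x y z → ApexOfVortex B k
  apexOfVortex {B = B} {x = x} {y} {z} lg d@(x≢y , x≢z , y≢z) k≢x k≢y k≢z sinkOrSource cyclic =
    x , y , z , d , k≢x , k≢y , k≢z
    , (nz k≢x , nz k≢y , nz k≢z , nz x≢y , nz x≢z , nz y≢z)
    , sinkOrSource , cyclic
    where
      nz : ∀ {u v} → u ≢ v → B u v ≢ + 0
      nz = large⇒nonzero {B = B} lg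

  mutate-row : ∀ k (B : Matrix n) v → mutate k B k v ≡ - B k v
  mutate-row k B v with k ≟ k
  ... | yes _   = refl
  ... | no k≢k  = contradiction refl k≢k

  mutate-col : ∀ k (B : Matrix n) → u ≢ k → mutate k B u k ≡ - B u k
  mutate-col {u} k B u≢k with u ≟ k | k ≟ k
  ... | yes u≡k | _      = contradiction u≡k u≢k
  ... | no _    | yes _  = refl
  ... | no _    | no k≢k = contradiction refl k≢k

  mutate-away : ∀ k (B : Matrix n) → u ≢ k → v ≢ k
              → mutate k B u v ≡ B u v + halfTerm (B u k) (B k v)
  mutate-away {u} {v} k B u≢k v≢k with u ≟ k | v ≟ k
  ... | yes u≡k | _       = contradiction u≡k u≢k
  ... | no _    | yes v≡k = contradiction v≡k v≢k
  ... | no _    | no _    = refl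

  mutate-unchanged : ∀ k (B : Matrix n) → u ≢ k → v ≢ k → OppositeSigns (B u k) (B k v)
                   → mutate k B u v ≡ B u v
  mutate-unchanged {u} {v} k B u≢k v≢k opp =
    trans (mutate-away k B u≢k v≢k) (trans (cong (λ h → B u v + h) (halfTerm-opposite opp)) (ℤ.+-identityʳ _))

  neg-skew : SkewSymmetric B → ∀ u v → - B u v ≡ B v u
  neg-skew {B} sk u v = trans (cong -_ (sk u v)) (ℤ.neg-involutive (B v u))

  negated-skew : SkewSymmetric B → ∀ {M : Matrix n} → M u v ≡ - B u v → M v u ≡ - B v u → M u v ≡ - M v u
  negated-skew {B} {u} {v} sk e e′ = trans e (cong -_ (trans (sk u v) (sym e′)))

  mutate-skew : ∀ k → SkewSymmetric B → SkewSymmetric (mutate k B)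
  mutate-skew {B} k sk u v = by-cases (u ≟ k) (v ≟ k)
    where
      by-cases : Dec (u ≡ k) → Dec (v ≡ k) → mutate k B u v ≡ - mutate k B v u
      by-cases (yes refl) (yes refl) = negated-skew sk {mutate k B} (mutate-row k B k) (mutate-row k B k)
      by-cases (yes refl) (no v≢k)   = negated-skew sk {mutate k B} (mutate-row k B v) (mutate-col k B v≢k)
      by-cases (no u≢k)   (yes refl) = negated-skew sk {mutate k B} (mutate-col k B u≢k) (mutate-row k B u)
      by-cases (no u≢k)   (no v≢k)   = begin
        mutate k B u v                         ≡⟨ mutate-away k B u≢k v≢k ⟩
        B u v + halfTerm (B u k) (B k v)       ≡⟨ cong₂ (λ b h → b + halfTerm h (B k v)) (sk u v) (sk u k) ⟩
        - B v u + halfTerm (- B k u) (B k v)   ≡⟨ cong (λ b → - B v u + halfTerm (- B k u) b) (sk k v) ⟩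
        - B v u + halfTerm (- B k u) (- B v k) ≡⟨ cong (λ h → - B v u + h) (neg-halfTerm (B k u) (B v k)) ⟩
        - B v u + - halfTerm (B k u) (B v k)   ≡⟨ cong (λ h → - B v u + - h) (halfTerm-comm (B k u) (B v k)) ⟩
        - B v u + - halfTerm (B v k) (B k u)   ≡⟨ ℤ.neg-distrib-+ (B v u) _ ⟨
        - (B v u + halfTerm (B v k) (B k u))   ≡⟨ cong -_ (mutate-away k B v≢k u≢k) ⟨
        - mutate k B v u                       ∎
        where open ≡-Reasoning

module MutationAt {n : ℕ} {B : Matrix n} {i : Fin n}
                  (sk : SkewSymmetric B) (lg : LargeWeights B) (ascent : CondA B i) where

  private
    variable
      k l u v x y z : Fin n

  μB : Matrix n
  μB = mutate i B

  μB-skew : SkewSymmetric μB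
  μB-skew = mutate-skew i sk

  μB-from-i : ∀ v → μB i v ≡ B v i
  μB-from-i v = trans (mutate-row i B v) (neg-skew sk i v)

  μB-to-i : v ≢ i → μB v i ≡ B i v
  μB-to-i {v} v≢i = trans (mutate-col i B v≢i) (neg-skew sk v i)

  side : v ≢ i → B ⊢ v ⟶ i ⊎ B ⊢ i ⟶ v
  side = arrow-either sk lg

  unchanged-in : u ≢ i → v ≢ i → B ⊢ u ⟶ i → B ⊢ v ⟶ i → μB u v ≡ B u v
  unchanged-in u≢i v≢i u→i v→i =
    mutate-unchanged i B u≢i v≢i (inj₂ (ℤ.<⇒≤ u→i , ℤ.<⇒≤ (skew-pos⇒neg sk v→i)))

  unchanged-out : u ≢ i → v ≢ i → B ⊢ i ⟶ u → B ⊢ i ⟶ v → μB u v ≡ B u v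
  unchanged-out u≢i v≢i i→u i→v =
    mutate-unchanged i B u≢i v≢i (inj₁ (ℤ.<⇒≤ (skew-pos⇒neg sk i→u) , ℤ.<⇒≤ i→v))

  path-through-i : u ≢ i → v ≢ i → B ⊢ u ⟶ i → B ⊢ i ⟶ v
                 → μB ⊢ u ⟶ v × ∣ B u v ∣ ℕ.≤ ∣ μB u v ∣
  path-through-i {u} {v} u≢i v≢i u→i i→v =
    subst (λ b → + 0 < b × ∣ B u v ∣ ℕ.≤ ∣ b ∣) (sym μBuv≡) (+-pos-∣∣-mono (B u v) (*-pos u→i i→v) grows)
    where
      μBuv≡ : μB u v ≡ B u v + B u i * B i v
      μBuv≡ = trans (mutate-away i B u≢i v≢i) (cong (λ h → B u v + h) (halfTerm-pos-pos u→i i→v))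
      grows : B u v < + 0 → ∣ B u v ∣ ℕ.< ∣ B u v + B u i * B i v ∣
      grows Buv<0 = subst (λ b → ∣ B u v ∣ ℕ.< ∣ b ∣) μBuv≡
                      (ascent u v (≢-sym u≢i , ≢-sym v≢i , u≢v) (inj₂ (u→i , skew-neg⇒pos sk Buv<0 , i→v)))
        where
          u≢v : u ≢ v
          u≢v refl = ℤ.<-irrefl (skew-diag sk u) Buv<0

  ∣∣-nondecreasing : ∀ u v → ∣ B u v ∣ ℕ.≤ ∣ μB u v ∣
  ∣∣-nondecreasing u v = by-cases (u ≟ i) (v ≟ i)
    where
      by-cases : Dec (u ≡ i) → Dec (v ≡ i) → ∣ B u v ∣ ℕ.≤ ∣ μB u v ∣
      by-cases (yes refl) _          = ℕ.≤-reflexive (sym (∣∣-≡-neg (mutate-row i B v)))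
      by-cases (no u≢i)   (yes refl) = ℕ.≤-reflexive (sym (∣∣-≡-neg (mutate-col i B u≢i)))
      by-cases (no u≢i)   (no v≢i) with side u≢i | side v≢i
      ... | inj₁ u→i | inj₁ v→i = ℕ.≤-reflexive (cong ∣_∣ (sym (unchanged-in u≢i v≢i u→i v→i)))
      ... | inj₂ i→u | inj₂ i→v = ℕ.≤-reflexive (cong ∣_∣ (sym (unchanged-out u≢i v≢i i→u i→v)))
      ... | inj₁ u→i | inj₂ i→v = proj₂ (path-through-i u≢i v≢i u→i i→v)
      ... | inj₂ i→u | inj₁ v→i =
        subst₂ ℕ._≤_ (skew-∣∣ sk v u) (skew-∣∣ μB-skew v u) (proj₂ (path-through-i v≢i u≢i v→i i→u))

  μB-large : LargeWeights μB
  μB-large u v u≢v = ℕ.≤-trans (lg u v u≢v) (∣∣-nondecreasing u v)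

  no-arrow-against-path : u ≢ i → v ≢ i → μB ⊢ u ⟶ v → B ⊢ v ⟶ i → B ⊢ i ⟶ u → ⊥
  no-arrow-against-path {u} {v} u≢i v≢i u⟶v v→i i→u =
    ℤ.<-asym u⟶v (skew-pos⇒neg {B = μB} {u = v} {v = u} μB-skew (proj₁ (path-through-i v≢i u≢i v→i i→u)))

  out-closed : u ≢ i → v ≢ i → μB ⊢ u ⟶ v → B ⊢ i ⟶ u → B ⊢ i ⟶ v
  out-closed u≢i v≢i u⟶v i→u with side v≢i
  ... | inj₁ v→i = contradiction i→u (no-arrow-against-path u≢i v≢i u⟶v v→i)
  ... | inj₂ i→v = i→v

  in-closed : u ≢ i → v ≢ i → μB ⊢ u ⟶ v → B ⊢ v ⟶ i → B ⊢ u ⟶ i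
  in-closed u≢i v≢i u⟶v v→i with side u≢i
  ... | inj₁ u→i = u→i
  ... | inj₂ i→u = contradiction i→u (no-arrow-against-path u≢i v≢i u⟶v v→i)

  triangle-ascent : k ≢ i → l ≢ i → k ≢ l → Cyclic3 μB k i l → Ascent μB k i l
  triangle-ascent {k} {l} k≢i l≢i k≢l cyclic =
    subst₂ ℕ._<_ (cong ∣_∣ (sym (mutate-row i B l))) (cong ∣_∣ (sym μμBil≡)) (by-orientation cyclic)
    where
      α = B k i
      β = B i l
      γ = B k l
      μBkl≡ : μB k l ≡ mutated-kl α β γ
      μBkl≡ = mutate-away i B k≢i l≢i
      μμBil≡ : mutate k μB i l ≡ mutated-il α β γ
      μμBil≡ = begin
        mutate k μB i l                          ≡⟨ mutate-away k μB (≢-sym k≢i) (≢-sym k≢l) ⟩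
        μB i l + halfTerm (μB i k) (μB k l)      ≡⟨ cong (λ b → b + halfTerm (μB i k) (μB k l)) (mutate-row i B l) ⟩
        - β + halfTerm (μB i k) (μB k l)         ≡⟨ cong₂ (λ a c → - β + halfTerm a c) (μB-from-i k) μBkl≡ ⟩
        - β + halfTerm α (mutated-kl α β γ)      ∎
        where open ≡-Reasoning
      grows : Cyclic3 B i k l → ∣ γ ∣ ℕ.< ∣ mutated-kl α β γ ∣
      grows cyclicB = subst (λ c → ∣ γ ∣ ℕ.< ∣ c ∣) μBkl≡ (ascent k l (≢-sym k≢i , ≢-sym l≢i , k≢l) cyclicB)
      by-orientation : Cyclic3 μB k i l → ∣ - β ∣ ℕ.< ∣ mutated-il α β γ ∣
      by-orientation (inj₁ (k⟶i , i⟶l , l⟶k)) =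
        triangle-ascent⁻ (skew-pos⇒neg sk i→k) (lg k i k≢i) (skew-pos⇒neg sk l→i)
          (subst (_< + 0) μBkl≡ (skew-pos⇒neg {u = l} {v = k} μB-skew l⟶k))
          (λ k→l → grows (inj₁ (i→k , k→l , l→i)))
        where
          i→k = subst (+ 0 <_) (μB-to-i k≢i) k⟶i
          l→i = subst (+ 0 <_) (μB-from-i l) i⟶l
      by-orientation (inj₂ (i⟶k , l⟶i , k⟶l)) =
        triangle-ascent⁺ k→i (lg k i k≢i) i→l (subst (+ 0 <_) μBkl≡ k⟶l)
          (λ γ<0 → grows (inj₂ (k→i , skew-neg⇒pos sk γ<0 , i→l)))
        where
          k→i = subst (+ 0 <_) (μB-from-i k) i⟶k
          i→l = subst (+ 0 <_) (μB-to-i l≢i) l⟶i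

  ¬SinkOrSource-through-i : k ≢ i → y ≢ i → z ≢ i → μB ⊢ i ⟶ y → μB ⊢ z ⟶ i → ¬ SinkOrSourceOf μB k i y z
  ¬SinkOrSource-through-i {k} {y} {z} k≢i y≢i z≢i i⟶y z⟶i (inj₁ (i⇢k , _ , z⇢k)) =
    ℤ.<⇒≱ (skew-pos⇒neg {u = k} {v = z} μB-skew (proj₁ (path-through-i k≢i z≢i k→i i→z))) z⇢k
    where
      k→i : B ⊢ k ⟶ i
      k→i = large-nonneg⇒pos {B = B} lg k≢i (subst (+ 0 ≤_) (μB-from-i k) i⇢k)
      i→z = subst (+ 0 <_) (μB-to-i z≢i) z⟶i
  ¬SinkOrSource-through-i {k} {y} {z} k≢i y≢i z≢i i⟶y z⟶i (inj₂ (k⇢i , k⇢y , _)) =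
    ℤ.<⇒≱ (skew-pos⇒neg {u = y} {v = k} μB-skew (proj₁ (path-through-i y≢i k≢i y→i i→k))) k⇢y
    where
      i→k : B ⊢ i ⟶ k
      i→k = large-nonneg⇒pos {B = B} lg (≢-sym k≢i) (subst (+ 0 ≤_) (μB-to-i k≢i) k⇢i)
      y→i = subst (+ 0 <_) (μB-from-i y) i⟶y

  ¬SinkOrSource-cyclic-through-i : k ≢ i → y ≢ i → z ≢ i → Cyclic3 μB i y z → ¬ SinkOrSourceOf μB k i y z
  ¬SinkOrSource-cyclic-through-i k≢i y≢i z≢i (inj₁ (i⟶y , _ , z⟶i)) =
    ¬SinkOrSource-through-i k≢i y≢i z≢i i⟶y z⟶i
  ¬SinkOrSource-cyclic-through-i {k} {y} {z} k≢i y≢i z≢i (inj₂ (y⟶i , _ , i⟶z)) sinkOrSource =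
    ¬SinkOrSource-through-i k≢i z≢i y≢i i⟶z y⟶i (SinkOrSourceOf-swap μB k i y z sinkOrSource)

  module _ (not-apex : CondC B i) where

    no-cycle-avoiding-i : Distinct3 x y z → x ≢ i → y ≢ i → z ≢ i
                        → μB ⊢ x ⟶ y → μB ⊢ y ⟶ z → μB ⊢ z ⟶ x → ⊥
    no-cycle-avoiding-i d x≢i y≢i z≢i x⟶y y⟶z z⟶x with side x≢i
    ... | inj₁ x→i = not-apex (apexOfVortex lg d (≢-sym x≢i) (≢-sym y≢i) (≢-sym z≢i)
                       (inj₁ (ℤ.<⇒≤ x→i , ℤ.<⇒≤ y→i , ℤ.<⇒≤ z→i))
                       (Cyclic3-transfer {B = μB} In (x≢i , x→i) (y≢i , y→i) (z≢i , z→i)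
                          (λ (p≢i , p→i) (q≢i , q→i) → unchanged-in p≢i q≢i p→i q→i)
                          (inj₁ (x⟶y , y⟶z , z⟶x))))
      where
        In : Fin n → Set
        In p = p ≢ i × B ⊢ p ⟶ i
        z→i = in-closed z≢i x≢i z⟶x x→i
        y→i = in-closed y≢i z≢i y⟶z z→i
    ... | inj₂ i→x = not-apex (apexOfVortex lg d (≢-sym x≢i) (≢-sym y≢i) (≢-sym z≢i)
                       (inj₂ (ℤ.<⇒≤ i→x , ℤ.<⇒≤ i→y , ℤ.<⇒≤ i→z))
                       (Cyclic3-transfer {B = μB} Out (x≢i , i→x) (y≢i , i→y) (z≢i , i→z)
                          (λ (p≢i , i→p) (q≢i , i→q) → unchanged-out p≢i q≢i i→p i→q)
                          (inj₁ (x⟶y , y⟶z , z⟶x))))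
      where
        Out : Fin n → Set
        Out p = p ≢ i × B ⊢ i ⟶ p
        i→y = out-closed x≢i y≢i x⟶y i→x
        i→z = out-closed y≢i z≢i y⟶z i→y

    no-cyclic-triangle-avoiding-i : Distinct3 x y z → x ≢ i → y ≢ i → z ≢ i → ¬ Cyclic3 μB x y z
    no-cyclic-triangle-avoiding-i d x≢i y≢i z≢i (inj₁ (x⟶y , y⟶z , z⟶x)) =
      no-cycle-avoiding-i d x≢i y≢i z≢i x⟶y y⟶z z⟶x
    no-cyclic-triangle-avoiding-i (x≢y , x≢z , y≢z) x≢i y≢i z≢i (inj₂ (y⟶x , z⟶y , x⟶z)) =
      no-cycle-avoiding-i (x≢z , x≢y , ≢-sym y≢z) x≢i z≢i y≢i x⟶z z⟶y y⟶x

    μB-condA : k ≢ i → CondA μB k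
    μB-condA {k} k≢i j l d@(k≢j , k≢l , j≢l) cyclic = by-cases (j ≟ i) (l ≟ i)
      where
        by-cases : Dec (j ≡ i) → Dec (l ≡ i) → Ascent μB k j l
        by-cases (yes refl) _          = triangle-ascent k≢i (≢-sym j≢l) k≢l cyclic
        by-cases (no j≢i)   (yes refl) =
          subst₂ ℕ._<_ (skew-∣∣ μB-skew i j) (skew-∣∣ (mutate-skew k μB-skew) i j)
            (triangle-ascent k≢i j≢i k≢j (Cyclic3-swap μB k j i cyclic))
        by-cases (no j≢i)   (no l≢i)   =
          contradiction cyclic (no-cyclic-triangle-avoiding-i d k≢i j≢i l≢i)

    μB-condC : k ≢ i → CondC μB k
    μB-condC {k} k≢i (x , y , z , d@(x≢y , x≢z , y≢z) , _ , _ , _ , _ , sinkOrSource , cyclic) =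
      by-cases (x ≟ i) (y ≟ i) (z ≟ i)
      where
        by-cases : Dec (x ≡ i) → Dec (y ≡ i) → Dec (z ≡ i) → ⊥
        by-cases (yes refl) _ _ =
          ¬SinkOrSource-cyclic-through-i k≢i (≢-sym x≢y) (≢-sym x≢z) cyclic sinkOrSource
        by-cases (no x≢i) (yes refl) _ =
          ¬SinkOrSource-cyclic-through-i k≢i (≢-sym y≢z) x≢i
            (Cyclic3-rotate μB x i z cyclic) (SinkOrSourceOf-rotate μB k x i z sinkOrSource)
        by-cases (no x≢i) (no y≢i) (yes refl) =
          ¬SinkOrSource-cyclic-through-i k≢i x≢i y≢i
            (Cyclic3-rotate μB y i x (Cyclic3-rotate μB x y i cyclic))
            (SinkOrSourceOf-rotate μB k y i x (SinkOrSourceOf-rotate μB k x y i sinkOrSource))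
        by-cases (no x≢i) (no y≢i) (no z≢i) = no-cyclic-triangle-avoiding-i d x≢i y≢i z≢i cyclic

Ascending : ∀ {n} → Matrix n → Fin n → Set
Ascending B i = SkewSymmetric B × LargeWeights B × CondA B i

mutate-sameOrientations : ∀ {n} {B B′ : Matrix n} {i} → Ascending B i → Ascending B′ i
                        → SameOrientations B B′ → SameOrientations (mutate i B) (mutate i B′)
mutate-sameOrientations {n} {B} {B′} {i} (sk , lg , asc) (sk′ , lg′ , asc′) same u v = by-cases (u ≟ i) (v ≟ i)
  where
    module M = MutationAt sk lg asc
    module M′ = MutationAt sk′ lg′ asc′
    to : ∀ {p q} → B ⊢ p ⟶ q → B′ ⊢ p ⟶ q
    to {p} {q} = Equivalence.to (same p q)
    transport : ∀ {a b a′ b′} → a ≡ a′ → b ≡ b′ → (+ 0 < a ⇔ + 0 < b) → (+ 0 < a′ ⇔ + 0 < b′)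
    transport refl refl equiv = equiv
    by-cases : Dec (u ≡ i) → Dec (v ≡ i) → (M.μB ⊢ u ⟶ v) ⇔ (M′.μB ⊢ u ⟶ v)
    by-cases (yes refl) _          = transport (sym (M.μB-from-i v)) (sym (M′.μB-from-i v)) (same v i)
    by-cases (no u≢i)   (yes refl) = transport (sym (M.μB-to-i u≢i)) (sym (M′.μB-to-i u≢i)) (same i u)
    by-cases (no u≢i)   (no v≢i) with M.side u≢i | M.side v≢i
    ... | inj₁ u→i | inj₁ v→i =
      transport (sym (M.unchanged-in u≢i v≢i u→i v→i)) (sym (M′.unchanged-in u≢i v≢i (to u→i) (to v→i))) (same u v)
    ... | inj₂ i→u | inj₂ i→v =
      transport (sym (M.unchanged-out u≢i v≢i i→u i→v)) (sym (M′.unchanged-out u≢i v≢i (to i→u) (to i→v))) (same u v)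
    ... | inj₁ u→i | inj₂ i→v =
      mk⇔ (λ _ → proj₁ (M′.path-through-i u≢i v≢i (to u→i) (to i→v)))
          (λ _ → proj₁ (M.path-through-i u≢i v≢i u→i i→v))
    ... | inj₂ i→u | inj₁ v→i =
      mk⇔ (λ u⟶v → ⊥-elim (M.no-arrow-against-path u≢i v≢i u⟶v v→i i→u))
          (λ u⟶v → ⊥-elim (M′.no-arrow-against-path u≢i v≢i u⟶v (to v→i) (to i→u)))

-- The hypotheses of the theorem without (B), which the argument never uses.
Admissible⁻ : ∀ {n} → Matrix n → Fin n → Set
Admissible⁻ B i = Ascending B i × CondC B i

mutate-admissible⁻ : ∀ {n} {B : Matrix n} {i k} → Admissible⁻ B i → k ≢ i → Admissible⁻ (mutate i B) k
mutate-admissible⁻ ((sk , lg , asc) , not-apex) k≢i =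
  (μB-skew , μB-large , μB-condA not-apex k≢i) , μB-condC not-apex k≢i
  where open MutationAt sk lg asc

mutSeq-sameOrientations : ∀ {n} {B B′ : Matrix n} {i} is → Admissible⁻ B i → Admissible⁻ B′ i
                        → SameOrientations B B′ → Linked _≢_ (i ∷ is)
                        → SameOrientations (mutSeq B (i ∷ is)) (mutSeq B′ (i ∷ is))
mutSeq-sameOrientations []       (asc , _) (asc′ , _) same _ = mutate-sameOrientations asc asc′ same
mutSeq-sameOrientations (k ∷ ks) adm adm′ same (i≢k ∷ linked) =
  mutSeq-sameOrientations ks (mutate-admissible⁻ adm k≢i) (mutate-admissible⁻ adm′ k≢i)
    (mutate-sameOrientations (proj₁ adm) (proj₁ adm′) same) linked
  where k≢i = ≢-sym i≢k

lemma6p14 : ∀ {n : ℕ} (B B' : Matrix n) (i : Fin n) (is : List (Fin n))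
    → Admissible B i → Admissible B' i
    → SameOrientations B B'
    → Linked _≢_ (i ∷ is)
    → SameOrientations (mutSeq B (i ∷ is)) (mutSeq B' (i ∷ is))
lemma6p14 B B' i is (sk , lg , asc , _ , not-apex) (sk′ , lg′ , asc′ , _ , not-apex′) =
  mutSeq-sameOrientations is ((sk , lg , asc) , not-apex) ((sk′ , lg′ , asc′) , not-apex′)
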